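{- Let $(V,*)$ be a travel groupoid, for $u,v\in V$ let $V_{u,v}=\{w\in V\mid u*w=v\}$, and write $x*^2y:=(x*y)*y$. Then the following are equivalent: (a) $(V,*)$ is semi-smooth, i.e. for all $u,v,w\in V$, if $u*v=u*w$ then $u*(v*w)=u*v$ or $u*((v*w)*w)=u*v$; (b) for all $u,v,x,y\in V$, if $x,y\in V_{u,v}$ then $x*y\in V_{u,v}$ or $x*^2y\in V_{u,v}$; (c) for all $u,v,x,y,z,w\in V$, if $x,y\in V_{u,v}$ and $x\in V_{y,z}\cap V_{z,w}$, then $z\in V_{u,v}$ or $w\in V_{u,v}$.
   Context: A travel groupoid is a nonempty set $V$ with a binary operation $*$ satisfying (t1) $(u*v)*u=u$ for all $u,v\in V$, and (t2) for all $u,v\in V$, if $(u*v)*v=u$ then $u=v$. -}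

module Defs where

open import Level using (Level; suc; _⊔_)
open import Relation.Binary.PropositionalEquality using (_≡_)
open import Data.Sum using (_⊎_)

record TravelGroupoid (ℓ : Level) : Set (suc ℓ) where
  infixl 7 _*_
  field
    V    : Set ℓ
    _*_  : V → V → V
    elem : V
    t1   : ∀ u v → (u * v) * u ≡ u
    t2   : ∀ u v → (u * v) * v ≡ u → u ≡ v

module _ {ℓ : Level} (G : TravelGroupoid ℓ) where
  open TravelGroupoid G

  _*²_ : V → V → V
  x *² y = (x * y) * y

  _∈V[_,_] : V → V → V → Set ℓ
  w ∈V[ u , v ] = u * w ≡ v

  SemiSmooth : Set ℓ
  SemiSmooth = ∀ u v w → u * v ≡ u * w →
    (u * (v * w) ≡ u * v) ⊎ (u * ((v * w) * w) ≡ u * v)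

  ConditionB : Set ℓ
  ConditionB = ∀ u v x y → x ∈V[ u , v ] → y ∈V[ u , v ] →
    (x * y) ∈V[ u , v ] ⊎ (x *² y) ∈V[ u , v ]

  ConditionC : Set ℓ
  ConditionC = ∀ u v x y z w → x ∈V[ u , v ] → y ∈V[ u , v ] →
    x ∈V[ y , z ] → x ∈V[ z , w ] →
    z ∈V[ u , v ] ⊎ w ∈V[ u , v ]

module Submission where

-- None of the three equivalences needs the travel-groupoid axioms; each is a
-- reformulation obtained by naming the relevant elements.
--   * (a) ⇒ (b): for x, y ∈ V_{u,v} we have u * x = u * y, so semi-smoothness
--     at (u, x, y) gives u * (x * y) = u * x = v or u * (x *² y) = u * x = v.
--   * (b) ⇒ (a): given u * v = u * w, both v and w lie in V_{u, u*v}.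
--   * (b) ⇔ (c): the hypotheses x ∈ V_{y,z} and x ∈ V_{z,w} of (c) say
--     z = y * x and w = (y * x) * x = y *² x, so (c) is (b) for the pair (y, x).

open import Defs
open import Level using (Level)
open import Data.Product using (_×_; _,_)
open import Data.Sum using (inj₁; inj₂)
open import Function.Bundles using (_⇔_; mk⇔)
open import Relation.Binary.PropositionalEquality using (refl; sym; trans)

module _ {ℓ : Level} (G : TravelGroupoid ℓ) where
  open TravelGroupoid G

  semiSmooth⇒conditionB : SemiSmooth G → ConditionB G
  semiSmooth⇒conditionB semiSmooth u v x y x∈ y∈
    with semiSmooth u x y (trans x∈ (sym y∈))
  ... | inj₁ u*[x*y]≡u*x = inj₁ (trans u*[x*y]≡u*x x∈)
  ... | inj₂ u*[x*²y]≡u*x = inj₂ (trans u*[x*²y]≡u*x x∈)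

  conditionB⇒semiSmooth : ConditionB G → SemiSmooth G
  conditionB⇒semiSmooth condB u v w u*v≡u*w = condB u (u * v) v w refl (sym u*v≡u*w)

  conditionB⇒conditionC : ConditionB G → ConditionC G
  conditionB⇒conditionC condB u v x y _ _ x∈ y∈ refl refl = condB u v y x y∈ x∈

  conditionC⇒conditionB : ConditionC G → ConditionB G
  conditionC⇒conditionB condC u v x y x∈ y∈ =
    condC u v y x (x * y) ((x * y) * y) y∈ x∈ refl refl

proposition4p12 : ∀ {ℓ : Level} (G : TravelGroupoid ℓ) →
    (SemiSmooth G ⇔ ConditionB G) × (ConditionB G ⇔ ConditionC G)
proposition4p12 G =
    mk⇔ (semiSmooth⇒conditionB G) (conditionB⇒semiSmooth G)
  , mk⇔ (conditionB⇒conditionC G) (conditionC⇒conditionB G)
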